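{- For any prime $p>7$, \[H_{p-1}+\frac p2H_{p-1,2}+\frac{p^2}6H_{p-1,3}\equiv0\pmod{p^6}.\]
   Context: $H_{n,s}=\sum_{0<k\le n}\frac1{k^s}$ and $H_n=H_{n,1}$. Congruences between rational numbers modulo $p^m$ are understood in the ring of rationals whose denominators are prime to $p$. -}

module Defs where

open import Data.Nat as ℕ using (ℕ; zero; suc; _^_)
open import Data.Nat.Properties using (m^n≢0)
open import Data.Integer as ℤ using (ℤ; +_)
open import Data.Rational as ℚ using (ℚ; _+_; _*_; _-_; _/_)
open import Data.Product using (∃₂; _×_)
open import Relation.Nullary using (¬_)
open import Data.Nat.Divisibility using (_∣_)
open import Relation.Binary.PropositionalEquality using (_≡_)

inv-pow : ℕ → ℕ → ℚ
inv-pow i s = (+ 1 / (suc i ^ s)) {{m^n≢0 (suc i) s}}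

H : ℕ → ℕ → ℚ
H zero    s = ℚ.0ℚ
H (suc n) s = H n s + inv-pow n s

-- x ≡ y (mod m) in the ring of rationals whose denominators are prime to p
-- (m is the modulus, here p^k): x - y = m * (a / d) for some integer a and
-- some positive natural d = suc b with p ∤ d.
_≡_[mod_]over_ : ℚ → ℚ → ℕ → ℕ → Set
x ≡ y [mod m ]over p =
  ∃₂ λ (a : ℤ) (b : ℕ) → (¬ (p ∣ suc b)) × (x - y ≡ (+ m / 1) * (a / suc b))

{-# OPTIONS --safe #-}
-- For 0 < k < p write x_k = 1/k and g(t) = t + (p/2) t² + (p²/6) t³. Since
-- x_k + x_{p-k} = p x_k x_{p-k}, the pair {k, p-k} contributes
-- g(x_k) + g(x_{p-k}) = (p⁵/6) (x_k x_{p-k})³, the terms in p and p³ cancelling.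
-- So twice the sum is (p⁵/6) Σ_k (x_k x_{p-k})³, and it remains to see that this
-- last sum is divisible by p. As x_{p-k} ≡ -x_k (mod p) it is ≡ -Σ_k x_k⁶, and
-- Σ_k x_k⁶ ≡ 2⁻⁶ Σ_k x_k⁶ (mod p): the even k = 2j give 2⁻⁶ x_j⁶, and the odd
-- k ≡ k + p = 2j give 2⁻⁶ x_j⁶ for the remaining j. Since p ∤ 63, Σ_k x_k⁶ ≡ 0.
module Submission where

open import Defs
open import Data.Nat using (ℕ; _>_; _∸_; _^_)
open import Data.Nat.Primality using (Prime)
open import Data.Integer using (+_)
open import Data.Rational using (_+_; _*_; _/_; 0ℚ)

open import Algebra.Bundles using (CommutativeMonoid; CommutativeRing)
open import Data.Empty using (⊥-elim)
open import Data.Integer as ℤ using (ℤ)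
import Data.Integer.Properties as ℤP
open import Data.Nat as ℕ using (zero; suc; _<_; z≤n; s≤s)
open import Data.Nat.Divisibility using (_∣_; divides; >⇒∤; ∣1⇒≡1)
open import Data.Nat.Primality
  using (euclidsLemma; prime⇒nonZero; prime⇒nonTrivial; prime⇒¬composite; composite-≢)
import Data.Nat.Properties as ℕP
open import Data.Nat.Tactic.RingSolver using (solve-∀)
open import Data.Product using (∃; ∃₂; _×_; _,_)
open import Data.Rational as ℚ using (ℚ; 1ℚ; -_; _-_; toℚᵘ)
import Data.Rational.Properties as ℚP
import Data.Rational.Unnormalised as ℚᵘ
import Data.Rational.Unnormalised.Properties as ℚᵘP
open import Data.Rational.Solver using (module +-*-Solver)
open import Data.Sum using (_⊎_; inj₁; inj₂; [_,_]′)
open import Relation.Binary.PropositionalEquality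
open import Relation.Nullary using (¬_)

open import Algebra.Properties.CommutativeSemigroup
  (CommutativeMonoid.commutativeSemigroup ℚP.*-1-commutativeMonoid)
  using () renaming (interchange to *-interchange)
open import Algebra.Properties.CommutativeSemigroup
  (CommutativeMonoid.commutativeSemigroup ℚP.+-0-commutativeMonoid)
  using () renaming (interchange to +-interchange)
open import Algebra.Properties.CommutativeSemiring.Exp
  (CommutativeRing.commutativeSemiring ℚP.+-*-commutativeRing)
  using (^-distrib-*) renaming (_^_ to _^ℚ_)
open +-*-Solver

toℚᵘ-/ : ∀ a b → toℚᵘ (a / suc b) ℚᵘ.≃ ℚᵘ.mkℚᵘ a b
toℚᵘ-/ a b = ℚP.toℚᵘ-fromℚᵘ (ℚᵘ.mkℚᵘ a b)

*≡*⇒/≡/ : ∀ a b c e → a ℤ.* + suc e ≡ c ℤ.* + suc b → a / suc b ≡ c / suc e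
*≡*⇒/≡/ a b c e eq = ℚP.fromℚᵘ-cong {ℚᵘ.mkℚᵘ a b} {ℚᵘ.mkℚᵘ c e} (ℚᵘ.*≡* eq)

/-* : ∀ a b c e → (a / suc b) * (c / suc e) ≡ (a ℤ.* c) / (suc b ℕ.* suc e)
/-* a b c e = ℚP.toℚᵘ-injective (ℚᵘP.≃-trans (ℚP.toℚᵘ-homo-* (a / suc b) (c / suc e))
  (ℚᵘP.≃-trans (ℚᵘP.*-cong (toℚᵘ-/ a b) (toℚᵘ-/ c e)) (ℚᵘP.≃-sym (toℚᵘ-/ (a ℤ.* c) _))))

/-+ : ∀ a b c e →
      (a / suc b) + (c / suc e) ≡ (a ℤ.* + suc e ℤ.+ c ℤ.* + suc b) / (suc b ℕ.* suc e)
/-+ a b c e = ℚP.toℚᵘ-injective (ℚᵘP.≃-trans (ℚP.toℚᵘ-homo-+ (a / suc b) (c / suc e))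
  (ℚᵘP.≃-trans (ℚᵘP.+-cong (toℚᵘ-/ a b) (toℚᵘ-/ c e)) (ℚᵘP.≃-sym (toℚᵘ-/ _ _))))

neg-/ : ∀ a b → - (a / suc b) ≡ (ℤ.- a) / suc b
neg-/ a b = ℚP.toℚᵘ-injective (ℚᵘP.≃-trans (ℚP.toℚᵘ-homo‿- (a / suc b))
  (ℚᵘP.≃-trans (ℚᵘP.-‿cong (toℚᵘ-/ a b)) (ℚᵘP.≃-sym (toℚᵘ-/ (ℤ.- a) b))))

fromℕ : ℕ → ℚ
fromℕ k = + k / 1

fromℕ-+ : ∀ j k → fromℕ (j ℕ.+ k) ≡ fromℕ j + fromℕ k
fromℕ-+ j k = trans (cong (_/ 1) eq) (sym (/-+ (+ j) 0 (+ k) 0))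
  where
  eq : + (j ℕ.+ k) ≡ + j ℤ.* + 1 ℤ.+ + k ℤ.* + 1
  eq = trans (ℤP.pos-+ j k) (sym (cong₂ ℤ._+_ (ℤP.*-identityʳ (+ j)) (ℤP.*-identityʳ (+ k))))

fromℕ-* : ∀ j k → fromℕ (j ℕ.* k) ≡ fromℕ j * fromℕ k
fromℕ-* j k = trans (cong (_/ 1) (ℤP.pos-* j k)) (sym (/-* (+ j) 0 (+ k) 0))

fromℕ-^ : ∀ k s → fromℕ (k ^ s) ≡ fromℕ k ^ℚ s
fromℕ-^ k zero    = refl
fromℕ-^ k (suc s) = trans (fromℕ-* k (k ^ s)) (cong (fromℕ k *_) (fromℕ-^ k s))

/-as-* : ∀ k d → + k / suc d ≡ fromℕ k * (+ 1 / suc d)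
/-as-* k d = trans (*≡*⇒/≡/ (+ k) d (+ k ℤ.* + 1) (d ℕ.+ 0) eq) (sym (/-* (+ k) 0 (+ 1) d))
  where
  eq : + k ℤ.* + suc (d ℕ.+ 0) ≡ (+ k ℤ.* + 1) ℤ.* + suc d
  eq = trans (cong (λ e → + k ℤ.* + suc e) (ℕP.+-identityʳ d))
             (cong (ℤ._* + suc d) (sym (ℤP.*-identityʳ (+ k))))

fromℕ-*-1/ : ∀ n .{{_ : ℕ.NonZero n}} → fromℕ n * (+ 1 / n) ≡ 1ℚ
fromℕ-*-1/ (suc k) = trans (sym (/-as-* (suc k) k)) (*≡*⇒/≡/ (+ suc k) k (+ 1) 0 eq)
  where
  eq : + suc k ℤ.* + 1 ≡ + 1 ℤ.* + suc k
  eq = trans (ℤP.*-identityʳ (+ suc k)) (sym (ℤP.*-identityˡ (+ suc k)))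

*-inverse-unique : ∀ c {u v} → c * u ≡ 1ℚ → c * v ≡ 1ℚ → u ≡ v
*-inverse-unique c {u} {v} cu≡1 cv≡1 = begin
  u            ≡⟨ ℚP.*-identityʳ u ⟨
  u * 1ℚ       ≡⟨ cong (u *_) cv≡1 ⟨
  u * (c * v)  ≡⟨ solve 3 (λ c u v → u :* (c :* v) := (c :* u) :* v) refl c u v ⟩
  (c * u) * v  ≡⟨ cong (_* v) cu≡1 ⟩
  1ℚ * v       ≡⟨ ℚP.*-identityˡ v ⟩
  v            ∎
  where open ≡-Reasoning

*-inverse-* : ∀ a b u v → a * u ≡ 1ℚ → b * v ≡ 1ℚ → (a * b) * (u * v) ≡ 1ℚ
*-inverse-* a b u v au≡1 bv≡1 = trans (*-interchange a b u v) (cong₂ _*_ au≡1 bv≡1)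

^-inverse : ∀ {a u} s → a * u ≡ 1ℚ → a ^ℚ s * u ^ℚ s ≡ 1ℚ
^-inverse         zero    _    = refl
^-inverse {a} {u} (suc s) au≡1 = *-inverse-* a (a ^ℚ s) u (u ^ℚ s) au≡1 (^-inverse s au≡1)

inverses-+ : ∀ {a b x y} → a * x ≡ 1ℚ → b * y ≡ 1ℚ → x + y ≡ (a + b) * (x * y)
inverses-+ {a} {b} {x} {y} ax≡1 by≡1 = sym (begin
  (a + b) * (x * y)
    ≡⟨ solve 4 (λ a b x y → (a :+ b) :* (x :* y) := (a :* x) :* y :+ (b :* y) :* x) refl a b x y ⟩
  (a * x) * y + (b * y) * x  ≡⟨ cong₂ (λ s t → s * y + t * x) ax≡1 by≡1 ⟩
  1ℚ * y + 1ℚ * x            ≡⟨ solve 2 (λ x y → con 1ℚ :* y :+ con 1ℚ :* x := x :+ y) refl x y ⟩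
  x + y                      ∎)
  where open ≡-Reasoning

inverses-- : ∀ {a b w z} → a * w ≡ 1ℚ → (a + b) * z ≡ 1ℚ → w - z ≡ b * (z * w)
inverses-- {a} {b} {w} {z} aw≡1 [a+b]z≡1 = sym (begin
  b * (z * w)
    ≡⟨ solve 4 (λ a b z w → b :* (z :* w) := ((a :+ b) :* z) :* w :- (a :* w) :* z) refl a b z w ⟩
  ((a + b) * z) * w - (a * w) * z  ≡⟨ cong₂ (λ s t → s * w - t * z) [a+b]z≡1 aw≡1 ⟩
  1ℚ * w - 1ℚ * z                  ≡⟨ solve 2 (λ w z → con 1ℚ :* w :- con 1ℚ :* z := w :- z) refl w z ⟩
  w - z                            ∎)
  where open ≡-Reasoning

½ : ℚ
½ = + 1 / 2

recip : ℕ → ℚ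
recip i = inv-pow i 1

recip-inverse : ∀ i → fromℕ (suc i) * recip i ≡ 1ℚ
recip-inverse i =
  subst (λ k → fromℕ k * recip i ≡ 1ℚ) (ℕP.*-identityʳ (suc i)) (fromℕ-*-1/ (suc i ℕ.* 1))

inv-pow≡recip^ : ∀ i s → inv-pow i s ≡ recip i ^ℚ s
inv-pow≡recip^ i s = *-inverse-unique (fromℕ (suc i ^ s))
  (fromℕ-*-1/ (suc i ^ s) {{ℕP.m^n≢0 (suc i) s}})
  (subst (λ c → c * recip i ^ℚ s ≡ 1ℚ) (sym (fromℕ-^ (suc i) s)) (^-inverse s (recip-inverse i)))

½-recip-inverse : ∀ i → fromℕ (2 ℕ.* suc i) * (½ * recip i) ≡ 1ℚ
½-recip-inverse i = trans (cong (_* (½ * recip i)) (fromℕ-* 2 (suc i)))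
  (*-inverse-* (fromℕ 2) (fromℕ (suc i)) ½ (recip i) refl (recip-inverse i))

recip-double : ∀ i → recip (suc (i ℕ.+ i)) ≡ ½ * recip i
recip-double i = *-inverse-unique (fromℕ (suc (suc (i ℕ.+ i)))) (recip-inverse (suc (i ℕ.+ i)))
  (subst (λ k → fromℕ k * (½ * recip i) ≡ 1ℚ) (2[1+i]≡2+2i i) (½-recip-inverse i))
  where
  2[1+i]≡2+2i : ∀ i → 2 ℕ.* suc i ≡ suc (suc (i ℕ.+ i))
  2[1+i]≡2+2i = solve-∀

recip-+ : ∀ {i j p} → suc i ℕ.+ suc j ≡ p → recip i + recip j ≡ fromℕ p * (recip i * recip j)
recip-+ {i} {j} refl =
  trans (inverses-+ {fromℕ (suc i)} {fromℕ (suc j)} (recip-inverse i) (recip-inverse j))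
        (cong (_* (recip i * recip j)) (sym (fromℕ-+ (suc i) (suc j))))

recip-½recip : ∀ {i k} p → suc i ℕ.+ p ≡ 2 ℕ.* suc k →
               recip i - ½ * recip k ≡ fromℕ p * ((½ * recip k) * recip i)
recip-½recip {i} {k} p eq = inverses-- {fromℕ (suc i)} {fromℕ p} (recip-inverse i)
  (subst (λ c → c * (½ * recip k) ≡ 1ℚ) (trans (cong fromℕ (sym eq)) (fromℕ-+ (suc i) p))
         (½-recip-inverse k))

∑< : ℕ → (ℕ → ℚ) → ℚ
∑< zero    f = 0ℚ
∑< (suc n) f = ∑< n f + f n

infix 7 ∑<
syntax ∑< n (λ i → e) = ∑[ i < n ] e

∑-cong : ∀ n {f g} → (∀ i → i < n → f i ≡ g i) → ∑< n f ≡ ∑< n g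
∑-cong zero    f≡g = refl
∑-cong (suc n) f≡g =
  cong₂ _+_ (∑-cong n (λ i i<n → f≡g i (ℕP.m<n⇒m<1+n i<n))) (f≡g n ℕP.≤-refl)

∑-distrib-+ : ∀ n f g → ∑[ i < n ] (f i + g i) ≡ ∑< n f + ∑< n g
∑-distrib-+ zero    f g = refl
∑-distrib-+ (suc n) f g = trans (cong (_+ (f n + g n)) (∑-distrib-+ n f g))
  (+-interchange (∑< n f) (∑< n g) (f n) (g n))

∑-distrib-- : ∀ n f g → ∑[ i < n ] (f i - g i) ≡ ∑< n f - ∑< n g
∑-distrib-- zero    f g = refl
∑-distrib-- (suc n) f g = trans (cong (_+ (f n - g n)) (∑-distrib-- n f g))
  (solve 4 (λ F G a b → (F :- G) :+ (a :- b) := (F :+ a) :- (G :+ b)) refl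
           (∑< n f) (∑< n g) (f n) (g n))

∑-distribˡ-* : ∀ n c f → ∑[ i < n ] (c * f i) ≡ c * ∑< n f
∑-distribˡ-* zero    c f = sym (ℚP.*-zeroʳ c)
∑-distribˡ-* (suc n) c f = trans (cong (_+ (c * f n)) (∑-distribˡ-* n c f))
  (sym (ℚP.*-distribˡ-+ c (∑< n f) (f n)))

∑-unfoldˡ : ∀ n f → ∑< (suc n) f ≡ f 0 + ∑[ i < n ] f (suc i)
∑-unfoldˡ zero    f = ℚP.+-comm 0ℚ (f 0)
∑-unfoldˡ (suc n) f =
  trans (cong (_+ f (suc n)) (∑-unfoldˡ n f)) (ℚP.+-assoc (f 0) _ (f (suc n)))

∑-reverse : ∀ n f → ∑< n f ≡ ∑[ i < n ] f (n ∸ suc i)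
∑-reverse zero    f = refl
∑-reverse (suc n) f = trans (cong (_+ f n) (∑-reverse n f))
  (trans (ℚP.+-comm _ (f n)) (sym (∑-unfoldˡ n (λ i → f (n ∸ i)))))

∑-split : ∀ m n f → ∑< (m ℕ.+ n) f ≡ ∑< m f + ∑[ i < n ] f (m ℕ.+ i)
∑-split m zero    f rewrite ℕP.+-identityʳ m = sym (ℚP.+-identityʳ (∑< m f))
∑-split m (suc n) f rewrite ℕP.+-suc m n =
  trans (cong (_+ f (m ℕ.+ n)) (∑-split m n f)) (ℚP.+-assoc (∑< m f) _ _)

∑-even-odd : ∀ n f → ∑< (n ℕ.+ n) f ≡ ∑[ i < n ] f (i ℕ.+ i) + ∑[ i < n ] f (suc (i ℕ.+ i))
∑-even-odd zero    f = refl
∑-even-odd (suc n) f rewrite ℕP.+-suc n n = begin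
  ∑< (n ℕ.+ n) f + e + o  ≡⟨ cong (λ t → t + e + o) (∑-even-odd n f) ⟩
  E + O + e + o           ≡⟨ ℚP.+-assoc (E + O) e o ⟩
  E + O + (e + o)         ≡⟨ +-interchange E O e o ⟩
  (E + e) + (O + o)       ∎
  where
  open ≡-Reasoning
  E O e o : ℚ
  E = ∑[ i < n ] f (i ℕ.+ i)
  O = ∑[ i < n ] f (suc (i ℕ.+ i))
  e = f (n ℕ.+ n)
  o = f (suc (n ℕ.+ n))

Integral : ℕ → ℚ → Set
Integral p x = ∃₂ λ (a : ℤ) (b : ℕ) → ¬ p ∣ suc b × x ≡ a / suc b

Multiple : ℕ → ℚ → Set
Multiple p x = ∃ λ y → Integral p y × x ≡ fromℕ p * y

≡[mod]-from-multiple : ∀ {x y z} m {p} →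
                       x - y ≡ fromℕ m * z → Integral p z → x ≡ y [mod m ]over p
≡[mod]-from-multiple m x-y≡mz (a , b , p∤b , z≡a/b) =
  a , b , p∤b , trans x-y≡mz (cong (fromℕ m *_) z≡a/b)

module _ {p : ℕ} (p-prime : Prime p) where

  ∤-* : ∀ {a b} → ¬ p ∣ a → ¬ p ∣ b → ¬ p ∣ a ℕ.* b
  ∤-* p∤a p∤b p∣ab = [ p∤a , p∤b ]′ (euclidsLemma _ _ p-prime p∣ab)

  p∤1 : ¬ p ∣ 1
  p∤1 p∣1 = ℕ.nonTrivial⇒≢1 {{prime⇒nonTrivial p-prime}} (∣1⇒≡1 p∣1)

  integral-0 : Integral p 0ℚ
  integral-0 = + 0 , 0 , p∤1 , refl

  integral-recip : ∀ {i} → suc i < p → Integral p (recip i)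
  integral-recip {i} i<p =
    + 1 , i ℕ.* 1 , >⇒∤ (subst (_< p) (sym (ℕP.*-identityʳ (suc i))) i<p) , refl

  integral-* : ∀ {x y} → Integral p x → Integral p y → Integral p (x * y)
  integral-* (a , b , p∤b , refl) (c , e , p∤e , refl) =
    a ℤ.* c , _ , ∤-* p∤b p∤e , /-* a b c e

  integral-+ : ∀ {x y} → Integral p x → Integral p y → Integral p (x + y)
  integral-+ (a , b , p∤b , refl) (c , e , p∤e , refl) =
    a ℤ.* + suc e ℤ.+ c ℤ.* + suc b , _ , ∤-* p∤b p∤e , /-+ a b c e

  integral-neg : ∀ {x} → Integral p x → Integral p (- x)
  integral-neg (a , b , p∤b , refl) = ℤ.- a , b , p∤b , neg-/ a b

  integral-^ : ∀ {x} s → Integral p x → Integral p (x ^ℚ s)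
  integral-^ zero    _  = + 1 , 0 , p∤1 , refl
  integral-^ (suc s) ix = integral-* ix (integral-^ s ix)

  multiple-0 : Multiple p 0ℚ
  multiple-0 = 0ℚ , integral-0 , sym (ℚP.*-zeroʳ (fromℕ p))

  multiple-+ : ∀ {x y} → Multiple p x → Multiple p y → Multiple p (x + y)
  multiple-+ (u , iu , refl) (v , iv , refl) =
    u + v , integral-+ iu iv , sym (ℚP.*-distribˡ-+ (fromℕ p) u v)

  multiple-neg : ∀ {x} → Multiple p x → Multiple p (- x)
  multiple-neg (u , iu , refl) = - u , integral-neg iu , ℚP.neg-distribʳ-* (fromℕ p) u

  multiple-- : ∀ {x y} → Multiple p x → Multiple p y → Multiple p (x - y)
  multiple-- mx my = multiple-+ mx (multiple-neg my)

  multiple-*ˡ : ∀ {c x} → Integral p c → Multiple p x → Multiple p (c * x)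
  multiple-*ˡ {c} ic (u , iu , refl) =
    c * u , integral-* ic iu , solve 3 (λ c P u → c :* (P :* u) := P :* (c :* u)) refl c (fromℕ p) u

  multiple-∑ : ∀ n f → (∀ i → i < n → Multiple p (f i)) → Multiple p (∑< n f)
  multiple-∑ zero    f mf = multiple-0
  multiple-∑ (suc n) f mf =
    multiple-+ (multiple-∑ n f (λ i i<n → mf i (ℕP.m<n⇒m<1+n i<n))) (mf n ℕP.≤-refl)

  multiple-^-^ : ∀ {w z} s → Integral p w → Integral p z →
                 Multiple p (w - z) → Multiple p (w ^ℚ s - z ^ℚ s)
  multiple-^-^ zero _ _ _ = multiple-0
  multiple-^-^ {w} {z} (suc s) iw iz m[w-z] = subst (Multiple p) (sym split)
    (multiple-+ (multiple-*ˡ iw (multiple-^-^ s iw iz m[w-z])) (multiple-*ˡ (integral-^ s iz) m[w-z]))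
    where
    split : w ^ℚ suc s - z ^ℚ suc s ≡ w * (w ^ℚ s - z ^ℚ s) + z ^ℚ s * (w - z)
    split = solve 4 (λ w z W Z → w :* W :- z :* Z := w :* (W :- Z) :+ Z :* (w :- z)) refl
                    w z (w ^ℚ s) (z ^ℚ s)

power-sum-multiple : ∀ n → Prime (suc (n ℕ.+ n)) → ¬ suc (n ℕ.+ n) ∣ 2 →
  ∀ s {c} → Integral (suc (n ℕ.+ n)) c → c * (1ℚ - ½ ^ℚ s) ≡ 1ℚ →
  Multiple (suc (n ℕ.+ n)) (∑[ i < n ℕ.+ n ] recip i ^ℚ s)
power-sum-multiple n p-prime p∤2 s {c} ic c[1-½^s]≡1 = subst (Multiple p) c[A-B]≡A
  (multiple-*ˡ p-prime ic (subst (Multiple p) (sym A-B≡∑) (multiple-∑ p-prime n _ term)))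
  where
  open ≡-Reasoning
  p = suc (n ℕ.+ n)

  A B : ℚ
  A = ∑[ i < n ℕ.+ n ] recip i ^ℚ s
  B = ∑[ i < n ℕ.+ n ] (½ * recip i) ^ℚ s

  B≡½^sA : B ≡ ½ ^ℚ s * A
  B≡½^sA = trans (∑-cong (n ℕ.+ n) (λ i _ → ^-distrib-* ½ (recip i) s))
                 (∑-distribˡ-* (n ℕ.+ n) (½ ^ℚ s) (λ i → recip i ^ℚ s))

  c[A-B]≡A : c * (A - B) ≡ A
  c[A-B]≡A = begin
    c * (A - B)               ≡⟨ cong (λ t → c * (A - t)) B≡½^sA ⟩
    c * (A - ½ ^ℚ s * A)
      ≡⟨ solve 3 (λ c h A → c :* (A :- h :* A) := (c :* (con 1ℚ :- h)) :* A) refl c (½ ^ℚ s) A ⟩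
    (c * (1ℚ - ½ ^ℚ s)) * A   ≡⟨ cong (_* A) c[1-½^s]≡1 ⟩
    1ℚ * A                    ≡⟨ ℚP.*-identityˡ A ⟩
    A                         ∎

  E O N : ℚ
  E = ∑[ i < n ] recip (i ℕ.+ i) ^ℚ s
  O = ∑[ i < n ] (½ * recip i) ^ℚ s
  N = ∑[ i < n ] (½ * recip (n ℕ.+ i)) ^ℚ s

  A-B≡∑ : A - B ≡ ∑[ i < n ] (recip (i ℕ.+ i) ^ℚ s - (½ * recip (n ℕ.+ i)) ^ℚ s)
  A-B≡∑ = begin
    A - B
      ≡⟨ cong₂ _-_ (∑-even-odd n (λ i → recip i ^ℚ s)) (∑-split n n (λ i → (½ * recip i) ^ℚ s)) ⟩
    (E + ∑[ i < n ] recip (suc (i ℕ.+ i)) ^ℚ s) - (O + N)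
      ≡⟨ cong (λ t → (E + t) - (O + N)) (∑-cong n (λ i _ → cong (_^ℚ s) (recip-double i))) ⟩
    (E + O) - (O + N)
      ≡⟨ solve 3 (λ E O N → (E :+ O) :- (O :+ N) := E :- N) refl E O N ⟩
    E - N
      ≡⟨ ∑-distrib-- n (λ i → recip (i ℕ.+ i) ^ℚ s) (λ i → (½ * recip (n ℕ.+ i)) ^ℚ s) ⟨
    ∑[ i < n ] (recip (i ℕ.+ i) ^ℚ s - (½ * recip (n ℕ.+ i)) ^ℚ s) ∎

  term : ∀ i → i < n → Multiple p (recip (i ℕ.+ i) ^ℚ s - (½ * recip (n ℕ.+ i)) ^ℚ s)
  term i i<n = multiple-^-^ p-prime s i[w] i[z]
    (z * w , integral-* p-prime i[z] i[w] , recip-½recip p (index n i))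
    where
    w z : ℚ
    w = recip (i ℕ.+ i)
    z = ½ * recip (n ℕ.+ i)
    i[w] : Integral p w
    i[w] = integral-recip p-prime (s≤s (ℕP.+-mono-< i<n i<n))
    i[z] : Integral p z
    i[z] = integral-* p-prime (+ 1 , 1 , p∤2 , refl)
                              (integral-recip p-prime (s≤s (ℕP.+-monoʳ-< n i<n)))
    index : ∀ n i → suc (i ℕ.+ i) ℕ.+ suc (n ℕ.+ n) ≡ 2 ℕ.* suc (n ℕ.+ i)
    index = solve-∀

cubic : ℚ → ℚ → ℚ → ℚ
cubic c₂ c₃ t = t + c₂ * t ^ℚ 2 + c₃ * t ^ℚ 3

H-combination≡∑cubic : ∀ m c₂ c₃ →
                       H m 1 + c₂ * H m 2 + c₃ * H m 3 ≡ ∑[ i < m ] cubic c₂ c₃ (recip i)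
H-combination≡∑cubic zero    c₂ c₃ =
  solve 2 (λ c₂ c₃ → con 0ℚ :+ c₂ :* con 0ℚ :+ c₃ :* con 0ℚ := con 0ℚ) refl c₂ c₃
H-combination≡∑cubic (suc m) c₂ c₃ = begin
  (H m 1 + x) + c₂ * (H m 2 + inv-pow m 2) + c₃ * (H m 3 + inv-pow m 3)
    ≡⟨ solve 8 (λ A B C a b c c₂ c₃ → (A :+ a) :+ c₂ :* (B :+ b) :+ c₃ :* (C :+ c)
                                    := (A :+ c₂ :* B :+ c₃ :* C) :+ (a :+ c₂ :* b :+ c₃ :* c))
         refl (H m 1) (H m 2) (H m 3) x (inv-pow m 2) (inv-pow m 3) c₂ c₃ ⟩
  (H m 1 + c₂ * H m 2 + c₃ * H m 3) + (x + c₂ * inv-pow m 2 + c₃ * inv-pow m 3)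
    ≡⟨ cong₂ _+_ (H-combination≡∑cubic m c₂ c₃)
                 (cong₂ (λ a b → x + c₂ * a + c₃ * b) (inv-pow≡recip^ m 2) (inv-pow≡recip^ m 3)) ⟩
  ∑[ i < m ] cubic c₂ c₃ (recip i) + cubic c₂ c₃ x ∎
  where
  open ≡-Reasoning
  x = recip m

cubic-pair : ∀ P c₂ c₃ x y → c₂ + c₂ ≡ P → c₃ + c₃ + c₃ ≡ P * c₂ → x + y ≡ P * (x * y) →
             cubic c₂ c₃ x + cubic c₂ c₃ y ≡ c₃ * P ^ℚ 3 * (x * y) ^ℚ 3
cubic-pair P c₂ c₃ x y 2c₂≡P 3c₃≡Pc₂ x+y≡Pxy = begin
  cubic c₂ c₃ x + cubic c₂ c₃ y
    ≡⟨ solve 4 (λ c₂ c₃ x y →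
         (x :+ c₂ :* x :^ 2 :+ c₃ :* x :^ 3) :+ (y :+ c₂ :* y :^ 2 :+ c₃ :* y :^ 3)
         := (x :+ y) :+ c₂ :* ((x :+ y) :^ 2 :- (con 1ℚ :+ con 1ℚ) :* (x :* y))
              :+ c₃ :* ((x :+ y) :^ 3 :- (con 1ℚ :+ con 1ℚ :+ con 1ℚ) :* (x :* y) :* (x :+ y)))
         refl c₂ c₃ x y ⟩
  K (x + y)                          ≡⟨ cong K x+y≡Pxy ⟩
  K (P * q)
    ≡⟨ solve 4 (λ P c₂ c₃ q →
         P :* q :+ c₂ :* ((P :* q) :^ 2 :- (con 1ℚ :+ con 1ℚ) :* q)
              :+ c₃ :* ((P :* q) :^ 3 :- (con 1ℚ :+ con 1ℚ :+ con 1ℚ) :* q :* (P :* q))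
         := (P :- (c₂ :+ c₂)) :* q :+ P :* (P :* c₂ :- (c₃ :+ c₃ :+ c₃)) :* q :^ 2
              :+ c₃ :* P :^ 3 :* q :^ 3)
         refl P c₂ c₃ q ⟩
  M (c₂ + c₂) (c₃ + c₃ + c₃)         ≡⟨ cong₂ M 2c₂≡P 3c₃≡Pc₂ ⟩
  M P (P * c₂)
    ≡⟨ solve 4 (λ P c₂ c₃ q →
         (P :- P) :* q :+ P :* (P :* c₂ :- P :* c₂) :* q :^ 2 :+ c₃ :* P :^ 3 :* q :^ 3
         := c₃ :* P :^ 3 :* q :^ 3) refl P c₂ c₃ q ⟩
  c₃ * P ^ℚ 3 * q ^ℚ 3               ∎
  where
  open ≡-Reasoning
  q = x * y
  K : ℚ → ℚ
  K s = s + c₂ * (s ^ℚ 2 - (1ℚ + 1ℚ) * q) + c₃ * (s ^ℚ 3 - (1ℚ + 1ℚ + 1ℚ) * q * s)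
  M : ℚ → ℚ → ℚ
  M a b = (P - a) * q + P * (P * c₂ - b) * q ^ℚ 2 + c₃ * P ^ℚ 3 * q ^ℚ 3

module _ {n : ℕ} (p-prime : Prime (suc (n ℕ.+ n))) (7<p : 7 < suc (n ℕ.+ n)) where
  private
    m p : ℕ
    m = n ℕ.+ n
    p = suc m
    P : ℚ
    P = fromℕ p
    mirror : ℕ → ℕ
    mirror i = m ∸ suc i
    ⅙ : ℚ
    ⅙ = + 1 / 6

  p∤2 : ¬ p ∣ 2
  p∤2 = >⇒∤ (ℕP.≤-<-trans (s≤s (s≤s z≤n)) 7<p)

  p∤3 : ¬ p ∣ 3
  p∤3 = >⇒∤ (ℕP.≤-<-trans (s≤s (s≤s (s≤s z≤n))) 7<p)

  mirror-+ : ∀ {i} → i < m → suc i ℕ.+ suc (mirror i) ≡ p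
  mirror-+ {i} i<m = trans (ℕP.+-suc (suc i) (mirror i)) (cong suc (ℕP.m+[n∸m]≡n i<m))

  mirror-< : ∀ {i} → i < m → mirror i < m
  mirror-< i<m = ℕP.∸-monoʳ-< {m} (s≤s z≤n) i<m

  cube-pairs-multiple : Multiple p (∑[ i < m ] (recip i * recip (mirror i)) ^ℚ 3)
  cube-pairs-multiple = subst (Multiple p) [T+A]-A≡T (multiple-- p-prime T+A-multiple A-multiple)
    where
    T A : ℚ
    T = ∑[ i < m ] (recip i * recip (mirror i)) ^ℚ 3
    A = ∑[ i < m ] recip i ^ℚ 6

    [T+A]-A≡T : T + A - A ≡ T
    [T+A]-A≡T = solve 2 (λ T A → T :+ A :- A := T) refl T A

    A-multiple : Multiple p A
    A-multiple = power-sum-multiple n p-prime p∤2 6 (+ 64 , 62 , p∤63 , refl) refl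
      where
      p∤63 : ¬ p ∣ 63
      p∤63 = ∤-* p-prime (>⇒∤ 7<p) (∤-* p-prime p∤3 p∤3)

    pair : ∀ i → i < m → Multiple p ((recip i * recip (mirror i)) ^ℚ 3 + recip i ^ℚ 6)
    pair i i<m = subst (Multiple p) (sym factor) (multiple-*ˡ p-prime (integral-^ p-prime 3 ix)
      (multiple-^-^ p-prime 3 iy (integral-neg p-prime ix) (x * y , integral-* p-prime ix iy , y--x≡Pxy)))
      where
      x y : ℚ
      x = recip i
      y = recip (mirror i)
      ix = integral-recip p-prime (s≤s i<m)
      iy = integral-recip p-prime (s≤s (mirror-< i<m))
      y--x≡Pxy : y - - x ≡ P * (x * y)
      y--x≡Pxy = trans (solve 2 (λ x y → y :- :- x := x :+ y) refl x y) (recip-+ (mirror-+ i<m))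
      factor : (x * y) ^ℚ 3 + x ^ℚ 6 ≡ x ^ℚ 3 * (y ^ℚ 3 - (- x) ^ℚ 3)
      factor = solve 2 (λ x y → (x :* y) :^ 3 :+ x :^ 6 := x :^ 3 :* (y :^ 3 :- (:- x) :^ 3)) refl x y

    T+A-multiple : Multiple p (T + A)
    T+A-multiple = subst (Multiple p)
      (∑-distrib-+ m (λ i → (recip i * recip (mirror i)) ^ℚ 3) (λ i → recip i ^ℚ 6))
      (multiple-∑ p-prime m _ pair)

  ∑cubic-doubled : ∀ c₂ c₃ → c₂ + c₂ ≡ P → c₃ + c₃ + c₃ ≡ P * c₂ →
    let S = ∑[ i < m ] cubic c₂ c₃ (recip i) in
    S + S ≡ c₃ * P ^ℚ 3 * (∑[ i < m ] (recip i * recip (mirror i)) ^ℚ 3)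
  ∑cubic-doubled c₂ c₃ 2c₂≡P 3c₃≡Pc₂ = begin
    S + S                        ≡⟨ cong (λ t → S + t) (∑-reverse m g) ⟩
    S + ∑[ i < m ] g (mirror i)  ≡⟨ ∑-distrib-+ m g (λ i → g (mirror i)) ⟨
    ∑[ i < m ] (g i + g (mirror i))
      ≡⟨ ∑-cong m (λ i i<m → cubic-pair P c₂ c₃ (recip i) (recip (mirror i))
                                        2c₂≡P 3c₃≡Pc₂ (recip-+ (mirror-+ i<m))) ⟩
    ∑[ i < m ] (c₃ * P ^ℚ 3 * (recip i * recip (mirror i)) ^ℚ 3)
      ≡⟨ ∑-distribˡ-* m (c₃ * P ^ℚ 3) (λ i → (recip i * recip (mirror i)) ^ℚ 3) ⟩
    c₃ * P ^ℚ 3 * (∑[ i < m ] (recip i * recip (mirror i)) ^ℚ 3) ∎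
    where
    open ≡-Reasoning
    g : ℕ → ℚ
    g i = cubic c₂ c₃ (recip i)
    S = ∑< m g

  H-combination≡0 :
    (H m 1 + (+ p / 2) * H m 2 + (+ (p ^ 2) / 6) * H m 3) ≡ 0ℚ [mod p ^ 6 ]over p
  H-combination≡0 =
    let y , iy , T≡Py = cube-pairs-multiple
    in ≡[mod]-from-multiple {Hc} {0ℚ} (p ^ 6) (Hc-0≡ y T≡Py)
                            (integral-* p-prime (integral-* p-prime i½ i⅙) iy)
    where
    open ≡-Reasoning
    i½ : Integral p ½
    i½ = + 1 , 1 , p∤2 , refl
    i⅙ : Integral p ⅙
    i⅙ = + 1 , 5 , ∤-* p-prime p∤2 p∤3 , refl

    c₂ c₃ Hc S T : ℚ
    c₂ = + p / 2
    c₃ = + (p ^ 2) / 6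
    Hc = H m 1 + c₂ * H m 2 + c₃ * H m 3
    S = ∑[ i < m ] cubic c₂ c₃ (recip i)
    T = ∑[ i < m ] (recip i * recip (mirror i)) ^ℚ 3

    c₂≡P½ : c₂ ≡ P * ½
    c₂≡P½ = /-as-* p 1
    c₃≡P²⅙ : c₃ ≡ P ^ℚ 2 * ⅙
    c₃≡P²⅙ = trans (/-as-* (p ^ 2) 5) (cong (_* ⅙) (fromℕ-^ p 2))

    2c₂≡P : c₂ + c₂ ≡ P
    2c₂≡P = trans (cong (λ c → c + c) c₂≡P½) (solve 1 (λ P → P :* con ½ :+ P :* con ½ := P) refl P)
    3c₃≡Pc₂ : c₃ + c₃ + c₃ ≡ P * c₂
    3c₃≡Pc₂ = trans (cong (λ c → c + c + c) c₃≡P²⅙)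
      (trans (solve 1 (λ P → P :^ 2 :* con ⅙ :+ P :^ 2 :* con ⅙ :+ P :^ 2 :* con ⅙
                            := P :* (P :* con ½)) refl P)
             (cong (P *_) (sym c₂≡P½)))

    Hc-0≡ : ∀ y → T ≡ P * y → Hc - 0ℚ ≡ fromℕ (p ^ 6) * (½ * ⅙ * y)
    Hc-0≡ y T≡Py = begin
      Hc - 0ℚ                      ≡⟨ ℚP.+-identityʳ Hc ⟩
      Hc                           ≡⟨ H-combination≡∑cubic m c₂ c₃ ⟩
      S                            ≡⟨ solve 1 (λ S → S := con ½ :* (S :+ S)) refl S ⟩
      ½ * (S + S)                  ≡⟨ cong (½ *_) (∑cubic-doubled c₂ c₃ 2c₂≡P 3c₃≡Pc₂) ⟩
      ½ * (c₃ * P ^ℚ 3 * T)        ≡⟨ cong₂ (λ c t → ½ * (c * P ^ℚ 3 * t)) c₃≡P²⅙ T≡Py ⟩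
      ½ * (P ^ℚ 2 * ⅙ * P ^ℚ 3 * (P * y))
        ≡⟨ solve 2 (λ P y → con ½ :* (P :^ 2 :* con ⅙ :* P :^ 3 :* (P :* y))
                           := P :^ 6 :* (con ½ :* con ⅙ :* y)) refl P y ⟩
      P ^ℚ 6 * (½ * ⅙ * y)         ≡⟨ cong (_* (½ * ⅙ * y)) (fromℕ-^ p 6) ⟨
      fromℕ (p ^ 6) * (½ * ⅙ * y)  ∎

even-or-odd : ∀ k → ∃ λ n → k ≡ n ℕ.+ n ⊎ k ≡ suc (n ℕ.+ n)
even-or-odd zero = 0 , inj₁ refl
even-or-odd (suc k) with even-or-odd k
... | n , inj₁ refl = n , inj₂ refl
... | n , inj₂ refl = suc n , inj₁ (cong suc (sym (ℕP.+-suc n n)))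

odd-prime : ∀ {p} → Prime p → 2 < p → ∃ λ n → p ≡ suc (n ℕ.+ n)
odd-prime {p} p-prime 2<p with even-or-odd p
... | n , inj₂ p≡1+2n = n , p≡1+2n
... | n , inj₁ refl = ⊥-elim (prime⇒¬composite p-prime
        (composite-≢ 2 {{_}} {{prime⇒nonZero p-prime}} (ℕP.<⇒≢ 2<p) (divides n (n+n≡n*2 n))))
  where
  n+n≡n*2 : ∀ n → n ℕ.+ n ≡ n ℕ.* 2
  n+n≡n*2 = solve-∀

lemma3p7 : (p : ℕ) → Prime p → p > 7 →
    (H (p ∸ 1) 1 + (+ p / 2) * H (p ∸ 1) 2 + (+ (p ^ 2) / 6) * H (p ∸ 1) 3)
      ≡ 0ℚ [mod p ^ 6 ]over p
lemma3p7 p p-prime 7<p with odd-prime p-prime (ℕP.≤-<-trans (s≤s (s≤s z≤n)) 7<p)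
... | n , refl = H-combination≡0 {n} p-prime 7<p
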